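{- For each integer $d\geq 6$, there are infinitely many pairwise combinatorially inequivalent $d$-dimensional convex polytopes that are Forman--Ricci-positive.
   Context: Polytopes are convex polytopes, considered up to combinatorial equivalence (isomorphism of face lattices). For an edge $e$ of a polytope $P$, let $\mathcal{F}\uparrow(e)$ be the set of $2$-faces of $P$ containing $e$. Two distinct edges $e,e'$ are parallel neighbors if either (i) they share a vertex but are not contained in a common $2$-face, or (ii) they are vertex-disjoint but are contained in a common $2$-face. Let $\mathcal{E}(e)$ be the set of parallel neighbors of $e$. The Forman--Ricci curvature of $e$ is $\mathcal{F}(e)=|\mathcal{F}\uparrow(e)|+2-|\mathcal{E}(e)|$. A polytope is Forman--Ricci-positive if $\mathcal{F}(e)>0$ for every edge $e$. -}

module Defs where

open import Data.Nat using (ℕ; zero; suc; _<_)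
open import Data.Fin using (Fin; zero; suc)
open import Data.Fin.Subset using (Subset; _∈_; _∉_; ⁅_⁆; ∣_∣; _⊂_)
open import Data.Rational using (ℚ; 0ℚ; _+_; _*_; _≤_)
open import Data.List using (List; length)
open import Data.List.Relation.Unary.Unique.Propositional using (Unique)
import Data.List.Membership.Propositional as LM
open import Data.Product using (Σ; ∃; ∃-syntax; _×_)
open import Data.Sum using (_⊎_)
open import Relation.Binary.PropositionalEquality using (_≡_; _≢_)
open import Relation.Nullary using (¬_)
open import Function.Bundles using (_⇔_; _↔_; Inverse)

sumFin : ∀ {k} → (Fin k → ℚ) → ℚ
sumFin {zero}  f = 0ℚ
sumFin {suc k} f = f zero + sumFin (λ i → f (suc i))

Point : ℕ → Set
Point d = Fin d → ℚ

_·_ : ∀ {d} → Point d → Point d → ℚ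
c · x = sumFin (λ j → c j * x j)

Config : ℕ → ℕ → Set
Config d n = Fin n → Point d

-- S ⊆ {0..n-1} is (the vertex/point set of) a face of conv(p):
-- there is a valid inequality c·x ≤ b for all points, tight exactly on S.
-- (c = 0, b = 1 gives the empty face; c = 0, b = 0 the whole polytope.)
IsFace : ∀ {d n} → Config d n → Subset n → Set
IsFace {d} p S = ∃[ c ] ∃[ b ] (∀ i → (c · p i ≤ b) × ((i ∈ S) ⇔ (c · p i ≡ b)))

AffIndep : ∀ {d n k} → Config d n → (Fin k → Fin n) → Set
AffIndep p f =
  ∀ (λs : Fin _ → ℚ) → sumFin λs ≡ 0ℚ →
    (∀ j → sumFin (λ i → λs i * p (f i) j) ≡ 0ℚ) → ∀ i → λs i ≡ 0ℚ

HasIndep : ∀ {d n} → Config d n → Subset n → ℕ → Set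
HasIndep p S k = ∃[ f ] ((∀ i → f i ∈ S) × AffIndep {k = k} p f)

-- Convex polytope in ℚ^d given by its (distinct) vertices: every point is a
-- vertex (a face with exactly that one point), and the polytope is
-- d-dimensional (contains d+1 affinely independent vertices).
record Polytope (d : ℕ) : Set where
  field
    n      : ℕ
    pt     : Config d n
    vertex : ∀ i → IsFace pt ⁅ i ⁆
    full   : HasIndep pt Data.Fin.Subset.⊤ (suc d)
open Polytope public

module _ {d : ℕ} (P : Polytope d) where
  IsEdge : Subset (n P) → Set
  IsEdge S = IsFace (pt P) S × ∣ S ∣ ≡ 2

  Is2Face : Subset (n P) → Set
  Is2Face S = IsFace (pt P) S × HasIndep (pt P) S 3 × ¬ HasIndep (pt P) S 4

  Up : Subset (n P) → Subset (n P) → Set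
  Up e F = Is2Face F × (∀ i → i ∈ e → i ∈ F)

  CommonTwoFace : Subset (n P) → Subset (n P) → Set
  CommonTwoFace e e' = ∃[ F ] (Up e F × Up e' F)

  ShareVertex : Subset (n P) → Subset (n P) → Set
  ShareVertex e e' = ∃[ v ] (v ∈ e × v ∈ e')

  ParNb : Subset (n P) → Subset (n P) → Set
  ParNb e e' = IsEdge e' × e' ≢ e ×
    ((ShareVertex e e' × ¬ CommonTwoFace e e')
     ⊎ (¬ ShareVertex e e' × CommonTwoFace e e'))

HasCard : ∀ {n} → (Subset n → Set) → ℕ → Set
HasCard {n} Q k = Σ (List (Subset n)) λ l →
  Unique l × length l ≡ k × (∀ S → (S LM.∈ l) ⇔ Q S)

-- Forman–Ricci positive: F(e) = |F↑(e)| + 2 - |E(e)| > 0 for every edge e.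
FRPositive : ∀ {d} → Polytope d → Set
FRPositive P = ∀ e → IsEdge P e →
  ∃[ a ] ∃[ b ] (HasCard (Up P e) a × HasCard (ParNb P e) b × b < a Data.Nat.+ 2)

-- Combinatorial equivalence: a bijection of vertex sets carrying faces to faces
-- (faces are determined by their vertex sets, so this is face-lattice isomorphism).
CombEquiv : ∀ {d d'} → Polytope d → Polytope d' → Set
CombEquiv P Q = Σ (Fin (n P) ↔ Fin (n Q)) λ π →
  ∀ S T → (∀ i → (i ∈ S) ⇔ (Inverse.to π i ∈ T)) →
    IsFace (pt P) S ⇔ IsFace (pt Q) T

{-# OPTIONS --safe #-}
module Submission where

-- Take the cyclic polytopes C(n, d) = conv {(t, t², …, t^d) | t = 0, …, n - 1}, n > d ≥ 6.
-- Any d + 1 points of the moment curve are affinely independent (Vandermonde), so every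
-- 2-face is a triangle. Conversely, for nodes a, b, c the linear functional
-- x(t) ↦ (abc)² - ((t - a)(t - b)(t - c))² (degree 6 ≤ d, no constant term) is maximised
-- on the curve exactly at a, b, c, so every triangle is a 2-face. Hence two edges with a
-- common vertex lie in a common triangle, while two disjoint edges lie in no common 2-face:
-- no edge has a parallel neighbour, and F(e) = |F↑(e)| + 2 > 0. Different n give different
-- numbers of vertices.

open import Defs
open import Data.Nat using (ℕ; _≤_)
open import Data.Product using (Σ; _×_)
open import Relation.Binary.PropositionalEquality using (_≢_)
open import Relation.Nullary using (¬_)

open import Data.Empty using (⊥-elim)
open import Data.Fin as Fin using (Fin; zero; suc; toℕ; _↑ˡ_)
import Data.Fin.Properties as Fin
open import Data.Fin.Permutation using (↔⇒≡)
open import Data.Fin.Subset using (Subset; _∈_; ∣_∣; ⁅_⁆; inside; outside; _∪_)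
open import Data.Fin.Subset.Properties
  using (⊆-antisym; drop-there; _⊆?_; x∈⁅x⁆; x∈⁅y⁆⇒x≡y; ∈⊤; p⊆p∪q; q⊆p∪q; x∈p∪q⁻; x∈p∪q⁺)
import Data.Integer as ℤ
open import Data.List as List using (List)
open import Data.List.Membership.Propositional using () renaming (_∈_ to _∈ₗ_)
open import Data.List.Membership.Propositional.Properties
  using (∈-++⁺ˡ; ∈-++⁺ʳ; ∈-map⁺; ∈-map⁻; ∈-filter⁺; ∈-filter⁻)
import Data.List.Relation.Unary.AllPairs as AllPairs
import Data.List.Relation.Unary.Any as Any
open import Data.List.Relation.Unary.All using ([])
open import Data.List.Relation.Unary.Unique.Propositional using (Unique)
import Data.List.Relation.Unary.Unique.Propositional.Properties as Unique
open import Data.Nat as ℕ using (zero; suc; z≤n; s≤s)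
import Data.Nat.Properties as ℕ
open import Data.Product as Product using (_,_; ∃; proj₁; proj₂)
open import Data.Rational
  using (ℚ; 0ℚ; 1ℚ; ↥_; _+_; _*_; -_; _-_; 1/_; NonZero; ≢-nonZero; nonNegative; nonPositive; +-*-rawSemiring)
  renaming (_≤_ to _≤ℚ_)
open import Data.Rational.Literals using (fromℤ)
import Data.Rational.Properties as ℚ
open import Data.Rational.Solver using (module +-*-Solver)
open import Data.Sum as Sum using (_⊎_; inj₁; inj₂; [_,_]′)
open import Data.Vec using (Vec; []; _∷_; here; there; lookup)
import Data.Vec.Functional as Vector
import Data.Vec.Properties as Vec
open import Data.Vec.Relation.Unary.All using ([]; _∷_)
open import Data.Vec.Relation.Unary.AllPairs using ([]; _∷_)
open import Data.Vec.Relation.Unary.Unique.Propositional using () renaming (Unique to Distinct)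
open import Data.Vec.Relation.Unary.Unique.Propositional.Properties using (lookup-injective)
open import Function using (_∘_; id)
open import Function.Bundles using (_⇔_; mk⇔; module Equivalence)
open import Function.Definitions using (Injective)
open import Function.Properties.Equivalence using () renaming (trans to ⇔-trans)
open import Relation.Binary.PropositionalEquality using (_≡_; refl; sym; trans; cong; cong₂; subst; module ≡-Reasoning)
open import Relation.Nullary using (yes; no)
import Relation.Nullary.Decidable as Dec
open import Relation.Nullary.Decidable using (_×-dec_)
open import Relation.Unary using (Decidable)

open import Algebra.Definitions.RawSemiring +-*-rawSemiring using (_^_)
open import Algebra.Properties.Group ℚ.+-0-group using () renaming (x∙y⁻¹≈ε⇒x≈y to x-y≡0⇒x≡y)
open Equivalence using (to; from)
open +-*-Solver using (solve; _:=_; _:+_; _:*_; _:-_; :-_; _:^_; con)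

x*y≡0⇒x≡0∨y≡0 : ∀ x y → x * y ≡ 0ℚ → x ≡ 0ℚ ⊎ y ≡ 0ℚ
x*y≡0⇒x≡0∨y≡0 x y xy≡0 with x ℚ.≟ 0ℚ
... | yes x≡0 = inj₁ x≡0
... | no  x≢0 = inj₂ (begin
  y               ≡⟨ ℚ.*-identityˡ y ⟨
  1ℚ * y          ≡⟨ cong (_* y) (ℚ.*-inverseˡ x) ⟨
  1/ x * x * y    ≡⟨ ℚ.*-assoc (1/ x) x y ⟩
  1/ x * (x * y)  ≡⟨ cong (1/ x *_) xy≡0 ⟩
  1/ x * 0ℚ       ≡⟨ ℚ.*-zeroʳ (1/ x) ⟩
  0ℚ              ∎)
  where
  open ≡-Reasoning
  instance
    x-nonZero : NonZero x
    x-nonZero = ≢-nonZero x≢0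

x*x≥0 : ∀ x → 0ℚ ≤ℚ x * x
x*x≥0 x with ℚ.≤-total 0ℚ x
... | inj₁ 0≤x = ℚ.nonNegative⁻¹ _ {{ℚ.nonNeg*nonNeg⇒nonNeg x {{nonNegative 0≤x}} x {{nonNegative 0≤x}}}}
... | inj₂ x≤0 = ℚ.nonNegative⁻¹ _ {{ℚ.nonPos*nonPos⇒nonPos x {{nonPositive x≤0}} x {{nonPositive x≤0}}}}

p-x*x≤p : ∀ p x → p - x * x ≤ℚ p
p-x*x≤p p x = begin
  p - x * x  ≤⟨ ℚ.+-monoʳ-≤ p (ℚ.neg-antimono-≤ (x*x≥0 x)) ⟩
  p - 0ℚ     ≡⟨ ℚ.+-identityʳ p ⟩
  p          ∎
  where open ℚ.≤-Reasoning

p-x*x≡p⇒x≡0 : ∀ p x → p - x * x ≡ p → x ≡ 0ℚ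
p-x*x≡p⇒x≡0 p x eq = [ id , id ]′ (x*y≡0⇒x≡0∨y≡0 x x (begin
  x * x            ≡⟨ solve 2 (λ p x → x :* x := p :- (p :- x :* x)) refl p x ⟩
  p - (p - x * x)  ≡⟨ cong (λ q → p - q) eq ⟩
  p - p            ≡⟨ ℚ.+-inverseʳ p ⟩
  0ℚ               ∎))
  where open ≡-Reasoning

sumFin-cong : ∀ {k} {f g : Fin k → ℚ} → (∀ i → f i ≡ g i) → sumFin f ≡ sumFin g
sumFin-cong {zero}  f≗g = refl
sumFin-cong {suc k} f≗g = cong₂ _+_ (f≗g zero) (sumFin-cong (f≗g ∘ suc))

sumFin-zero : ∀ {k} {f : Fin k → ℚ} → (∀ i → f i ≡ 0ℚ) → sumFin f ≡ 0ℚ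
sumFin-zero {zero}  f≗0 = refl
sumFin-zero {suc k} f≗0 = cong₂ _+_ (f≗0 zero) (sumFin-zero (f≗0 ∘ suc))

sumFin-linear : ∀ {k} (f g : Fin k → ℚ) a → sumFin (λ i → f i - a * g i) ≡ sumFin f - a * sumFin g
sumFin-linear {zero}  f g a = solve 1 (λ a → con 0ℚ := con 0ℚ :- a :* con 0ℚ) refl a
sumFin-linear {suc k} f g a = trans
  (cong (f zero - a * g zero +_) (sumFin-linear (f ∘ suc) (g ∘ suc) a))
  (solve 5 (λ f₀ g₀ a F G → f₀ :- a :* g₀ :+ (F :- a :* G) := f₀ :+ F :- a :* (g₀ :+ G)) refl
    (f zero) (g zero) a (sumFin (f ∘ suc)) (sumFin (g ∘ suc)))

δ : ∀ {k} → Fin k → Fin k → ℚ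
δ zero    zero    = 1ℚ
δ zero    (suc _) = 0ℚ
δ (suc _) zero    = 0ℚ
δ (suc i) (suc x) = δ i x

δ-diag : ∀ {k} (i : Fin k) → δ i i ≡ 1ℚ
δ-diag zero    = refl
δ-diag (suc i) = δ-diag i

δ-offdiag : ∀ {k} {i j : Fin k} → i ≢ j → δ i j ≡ 0ℚ
δ-offdiag {i = zero}  {zero}  i≢j = ⊥-elim (i≢j refl)
δ-offdiag {i = zero}  {suc j} i≢j = refl
δ-offdiag {i = suc i} {zero}  i≢j = refl
δ-offdiag {i = suc i} {suc j} i≢j = δ-offdiag (i≢j ∘ cong suc)

sumFin-δ : ∀ {k} (i : Fin k) (g : Fin k → ℚ) → sumFin (λ x → δ i x * g x) ≡ g i
sumFin-δ zero g = begin
  1ℚ * g zero + sumFin (λ x → 0ℚ * g (suc x))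
    ≡⟨ cong (1ℚ * g zero +_) (sumFin-zero (ℚ.*-zeroˡ ∘ g ∘ suc)) ⟩
  1ℚ * g zero + 0ℚ                             ≡⟨ ℚ.+-identityʳ _ ⟩
  1ℚ * g zero                                  ≡⟨ ℚ.*-identityˡ _ ⟩
  g zero                                       ∎
  where open ≡-Reasoning
sumFin-δ (suc i) g = begin
  0ℚ * g zero + sumFin (λ x → δ i x * g (suc x))  ≡⟨ cong₂ _+_ (ℚ.*-zeroˡ (g zero)) (sumFin-δ i (g ∘ suc)) ⟩
  0ℚ + g (suc i)                                  ≡⟨ ℚ.+-identityˡ _ ⟩
  g (suc i)                                       ∎
  where open ≡-Reasoning

powerSum : ∀ {k} → (Fin k → ℚ) → (Fin k → ℚ) → ℕ → ℚ
powerSum l t e = sumFin (λ i → l i * t i ^ e)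

powerSum-shift : ∀ {m} (l t : Fin (suc m) → ℚ) e →
  powerSum (λ i → l (suc i) * (t (suc i) - t zero)) (t ∘ suc) e
    ≡ powerSum l t (suc e) - t zero * powerSum l t e
powerSum-shift l t e = begin
  powerSum (λ i → l (suc i) * (t (suc i) - t zero)) (t ∘ suc) e
    ≡⟨ sumFin-cong (λ i → expand (l (suc i)) (t (suc i)) t₀ (t (suc i) ^ e)) ⟩
  sumFin (λ i → l (suc i) * t (suc i) ^ suc e - t₀ * (l (suc i) * t (suc i) ^ e))
    ≡⟨ sumFin-linear (λ i → l (suc i) * t (suc i) ^ suc e) (λ i → l (suc i) * t (suc i) ^ e) t₀ ⟩
  B (suc e) - t₀ * B e
    ≡⟨ cancel (l zero) t₀ (t₀ ^ e) (B (suc e)) (B e) ⟨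
  powerSum l t (suc e) - t₀ * powerSum l t e
    ∎
  where
  open ≡-Reasoning
  t₀ : ℚ
  t₀ = t zero
  B : ℕ → ℚ
  B = powerSum (l ∘ suc) (t ∘ suc)
  expand : ∀ a x t₀ p → a * (x - t₀) * p ≡ a * (x * p) - t₀ * (a * p)
  expand = solve 4 (λ a x t₀ p → a :* (x :- t₀) :* p := a :* (x :* p) :- t₀ :* (a :* p)) refl
  cancel : ∀ a t₀ p B₁ B₀ → a * (t₀ * p) + B₁ - t₀ * (a * p + B₀) ≡ B₁ - t₀ * B₀
  cancel = solve 5 (λ a t₀ p B₁ B₀ → a :* (t₀ :* p) :+ B₁ :- t₀ :* (a :* p :+ B₀) := B₁ :- t₀ :* B₀) refl

tail≡0⇒head≡0 : ∀ {m} (l t : Fin (suc m) → ℚ) → (∀ i → l (suc i) ≡ 0ℚ) →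
                powerSum l t 0 ≡ 0ℚ → l zero ≡ 0ℚ
tail≡0⇒head≡0 l t tail≡0 Σl≡0 = begin
  l zero            ≡⟨ ℚ.*-identityʳ (l zero) ⟨
  l zero * 1ℚ       ≡⟨ ℚ.+-identityʳ _ ⟨
  l zero * 1ℚ + 0ℚ  ≡⟨ cong (l zero * 1ℚ +_) (sumFin-zero (λ i → cong (_* 1ℚ) (tail≡0 i))) ⟨
  powerSum l t 0    ≡⟨ Σl≡0 ⟩
  0ℚ                ∎
  where open ≡-Reasoning

vandermonde : ∀ m (l t : Fin (suc m) → ℚ) → Injective _≡_ _≡_ t →
              (∀ e → e ℕ.≤ m → powerSum l t e ≡ 0ℚ) → ∀ i → l i ≡ 0ℚ
vandermonde zero    l t t-inj l⊥ zero = tail≡0⇒head≡0 l t (λ ()) (l⊥ 0 z≤n)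
vandermonde (suc m) l t t-inj l⊥ = λ where
    zero    → tail≡0⇒head≡0 l t tail≡0 (l⊥ 0 z≤n)
    (suc i) → tail≡0 i
  where
  open ≡-Reasoning
  μ : Fin (suc m) → ℚ
  μ i = l (suc i) * (t (suc i) - t zero)
  μ⊥ : ∀ e → e ℕ.≤ m → powerSum μ (t ∘ suc) e ≡ 0ℚ
  μ⊥ e e≤m = begin
    powerSum μ (t ∘ suc) e                          ≡⟨ powerSum-shift l t e ⟩
    powerSum l t (suc e) - t zero * powerSum l t e
      ≡⟨ cong₂ (λ a b → a - t zero * b) (l⊥ (suc e) (s≤s e≤m)) (l⊥ e (ℕ.m≤n⇒m≤1+n e≤m)) ⟩
    0ℚ - t zero * 0ℚ                                ≡⟨ cong (λ x → 0ℚ - x) (ℚ.*-zeroʳ (t zero)) ⟩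
    0ℚ                                              ∎
  tail≡0 : ∀ i → l (suc i) ≡ 0ℚ
  tail≡0 i = [ id , (λ tᵢ-t₀≡0 → ⊥-elim (0≢suc (t-inj (sym (x-y≡0⇒x≡y _ _ tᵢ-t₀≡0))))) ]′
    (x*y≡0⇒x≡0∨y≡0 _ _ (vandermonde m μ (t ∘ suc) (Fin.suc-injective ∘ t-inj) μ⊥ i))
    where
    0≢suc : zero ≢ suc i
    0≢suc ()

affIndep⇒injective : ∀ {d n k} (p : Config d n) (f : Fin k → Fin n) → AffIndep p f → Injective _≡_ _≡_ f
affIndep⇒injective {k = k} p f indep {i} {j} fi≡fj with i Fin.≟ j
... | yes i≡j = i≡j
... | no  i≢j = ⊥-elim (1≢0 (trans (sym λs-i≡1) (indep λs Σλs≡0 Σλs·p≡0 i)))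
  where
  open ≡-Reasoning
  λs : Fin k → ℚ
  λs x = δ i x - δ j x
  λs-i≡1 : λs i ≡ 1ℚ
  λs-i≡1 = cong₂ _-_ (δ-diag i) (δ-offdiag (i≢j ∘ sym))
  pair-sum : ∀ g → sumFin (λ x → λs x * g x) ≡ g i - 1ℚ * g j
  pair-sum g = begin
    sumFin (λ x → λs x * g x)
      ≡⟨ sumFin-cong (λ x → solve 3 (λ a b c → (a :- b) :* c := a :* c :- con 1ℚ :* (b :* c)) refl
                                    (δ i x) (δ j x) (g x)) ⟩
    sumFin (λ x → δ i x * g x - 1ℚ * (δ j x * g x))
      ≡⟨ sumFin-linear (λ x → δ i x * g x) (λ x → δ j x * g x) 1ℚ ⟩
    sumFin (λ x → δ i x * g x) - 1ℚ * sumFin (λ x → δ j x * g x)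
      ≡⟨ cong₂ (λ a b → a - 1ℚ * b) (sumFin-δ i g) (sumFin-δ j g) ⟩
    g i - 1ℚ * g j
      ∎
  Σλs≡0 : sumFin λs ≡ 0ℚ
  Σλs≡0 = trans (sumFin-cong (sym ∘ ℚ.*-identityʳ ∘ λs)) (pair-sum (λ _ → 1ℚ))
  Σλs·p≡0 : ∀ c → sumFin (λ x → λs x * p (f x) c) ≡ 0ℚ
  Σλs·p≡0 c = begin
    sumFin (λ x → λs x * p (f x) c)  ≡⟨ pair-sum (λ x → p (f x) c) ⟩
    p (f i) c - 1ℚ * p (f j) c       ≡⟨ cong (λ y → p (f i) c - 1ℚ * p y c) fi≡fj ⟨
    p (f i) c - 1ℚ * p (f i) c       ≡⟨ solve 1 (λ a → a :- con 1ℚ :* a := con 0ℚ) refl (p (f i) c) ⟩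
    0ℚ                               ∎
  1≢0 : 1ℚ ≢ 0ℚ
  1≢0 ()

node : ∀ {n} → Fin n → ℚ
node i = fromℤ (ℤ.+ toℕ i)

node-injective : ∀ {n} → Injective _≡_ _≡_ (node {n})
node-injective eq = Fin.toℕ-injective (cong (ℤ.∣_∣ ∘ ↥_) eq)

moment : ∀ {D n} → Config D n
moment i j = node i ^ suc (toℕ j)

moment-affIndep : ∀ {D n k} {f : Fin k → Fin n} → k ℕ.≤ suc D → Injective _≡_ _≡_ f →
                  AffIndep (moment {D}) f
moment-affIndep {k = zero}      _         _     _  _     _        ()
moment-affIndep {D} {k = suc m} {f} (s≤s m≤D) f-inj λs Σλs≡0 Σλs·x≡0 =
  vandermonde m λs (node ∘ f) (f-inj ∘ node-injective) vanishes
  where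
  vanishes : ∀ e → e ℕ.≤ m → powerSum λs (node ∘ f) e ≡ 0ℚ
  vanishes zero    _   = trans (sumFin-cong (ℚ.*-identityʳ ∘ λs)) Σλs≡0
  vanishes (suc e) e<m = trans
    (sumFin-cong (λ i → cong (λ j → λs i * node (f i) ^ suc j) (sym (Fin.toℕ-fromℕ< e<D))))
    (Σλs·x≡0 (Fin.fromℕ< e<D))
    where
    e<D : e ℕ.< D
    e<D = ℕ.<-≤-trans e<m m≤D

_IsImageOf_ : ∀ {m n} → Subset n → (Fin m → Fin n) → Set
S IsImageOf g = ∀ i → i ∈ S ⇔ ∃ λ j → g j ≡ i

image-∈ : ∀ {m n} {S : Subset n} {g : Fin m → Fin n} → S IsImageOf g → ∀ j → g j ∈ S
image-∈ S≐g j = from (S≐g _) (j , refl)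

image-unique : ∀ {m n} {S T : Subset n} {g : Fin m → Fin n} → S IsImageOf g → T IsImageOf g → S ≡ T
image-unique S≐g T≐g = ⊆-antisym (λ {i} → from (T≐g i) ∘ to (S≐g i)) (λ {i} → from (S≐g i) ∘ to (T≐g i))

Enumeration : ∀ {n} → Subset n → ℕ → Set
Enumeration {n} S m = Σ (Fin m → Fin n) λ g → Injective _≡_ _≡_ g × S IsImageOf g

enumerate : ∀ {n} (S : Subset n) → Enumeration S ∣ S ∣
enumerate []            = (λ ()) , (λ { {()} }) , (λ ())
enumerate (outside ∷ S) with enumerate S
... | g , g-inj , S≐g = suc ∘ g , g-inj ∘ Fin.suc-injective , λ where
    zero    → mk⇔ (λ ()) (λ ())
    (suc i) → mk⇔ (λ i∈S → Product.map₂ (cong suc) (to (S≐g i) (drop-there i∈S)))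
                  (λ { (j , refl) → there (image-∈ S≐g j) })
enumerate (inside ∷ S) with enumerate S
... | g , g-inj , S≐g = zero Vector.∷ suc ∘ g , g′-inj , λ where
    zero    → mk⇔ (λ _ → zero , refl) (λ _ → here)
    (suc i) → mk⇔ (λ i∈S → Product.map suc (cong suc) (to (S≐g i) (drop-there i∈S)))
                  (λ { (suc j , refl) → there (image-∈ S≐g j) })
  where
  g′-inj : Injective _≡_ _≡_ (zero Vector.∷ suc ∘ g)
  g′-inj {zero}  {zero}  _  = refl
  g′-inj {suc j} {suc k} eq = cong suc (g-inj (Fin.suc-injective eq))

∣∣≡⇒enumeration : ∀ {m n} {S : Subset n} → ∣ S ∣ ≡ m → Enumeration S m
∣∣≡⇒enumeration {S = S} refl = enumerate S

pair-through : ∀ {n} {S : Subset n} {g : Fin 2 → Fin n} {v} → Injective _≡_ _≡_ g → S IsImageOf g → v ∈ S →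
               ∃ λ w → v ≢ w × S IsImageOf lookup (v ∷ w ∷ [])
pair-through {g = g} g-inj S≐g v∈S with to (S≐g _) v∈S
... | zero , refl = g (suc zero) , (λ ()) ∘ g-inj , λ i → ⇔-trans (S≐g i)
  (mk⇔ (λ { (zero , eq) → zero , eq ; (suc zero , eq) → suc zero , eq })
       (λ { (zero , eq) → zero , eq ; (suc zero , eq) → suc zero , eq }))
... | suc zero , refl = g zero , (λ ()) ∘ g-inj ∘ sym , λ i → ⇔-trans (S≐g i)
  (mk⇔ (λ { (zero , eq) → suc zero , eq ; (suc zero , eq) → zero , eq })
       (λ { (zero , eq) → suc zero , eq ; (suc zero , eq) → zero , eq }))

union-of-pairs : ∀ {n} {e e′ : Subset n} {v x y} →
                 e IsImageOf lookup (v ∷ x ∷ []) → e′ IsImageOf lookup (v ∷ y ∷ []) →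
                 (e ∪ e′) IsImageOf lookup (v ∷ x ∷ y ∷ [])
union-of-pairs {e = e} {e′} e≐ e′≐ i = mk⇔ (into ∘ x∈p∪q⁻ e e′) outof
  where
  into : i ∈ e ⊎ i ∈ e′ → ∃ λ j → lookup (_ ∷ _ ∷ _ ∷ []) j ≡ i
  into (inj₁ i∈e) with to (e≐ i) i∈e
  ... | zero     , eq = zero , eq
  ... | suc zero , eq = suc zero , eq
  into (inj₂ i∈e′) with to (e′≐ i) i∈e′
  ... | zero     , eq = zero , eq
  ... | suc zero , eq = suc (suc zero) , eq
  outof : (∃ λ j → lookup (_ ∷ _ ∷ _ ∷ []) j ≡ i) → i ∈ e ∪ e′
  outof (zero           , refl) = x∈p∪q⁺ (inj₁ (image-∈ e≐ zero))
  outof (suc zero       , refl) = x∈p∪q⁺ (inj₁ (image-∈ e≐ (suc zero)))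
  outof (suc (suc zero) , refl) = x∈p∪q⁺ (inj₂ (image-∈ e′≐ (suc zero)))

HasDistinct : ∀ {n} → Subset n → ℕ → Set
HasDistinct {n} S k = Σ (Fin k → Fin n) λ f → Injective _≡_ _≡_ f × (∀ x → f x ∈ S)

hasDistinct⇒≤ : ∀ {m n k} {S : Subset n} {g : Fin m → Fin n} → HasDistinct S k → S IsImageOf g → k ℕ.≤ m
hasDistinct⇒≤ {g = g} (f , f-inj , f∈S) S≐g = Fin.injective⇒≤ preimage-inj
  where
  preimage : ∀ x → ∃ λ j → g j ≡ f x
  preimage x = to (S≐g (f x)) (f∈S x)
  preimage-inj : Injective _≡_ _≡_ (proj₁ ∘ preimage)
  preimage-inj {x} {y} eq = f-inj (trans (sym (proj₂ (preimage x))) (trans (cong g eq) (proj₂ (preimage y))))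

hasDistinct⇒≤∣∣ : ∀ {n k} {S : Subset n} → HasDistinct S k → k ℕ.≤ ∣ S ∣
hasDistinct⇒≤∣∣ {S = S} distinct = hasDistinct⇒≤ distinct (proj₂ (proj₂ (enumerate S)))

≤∣∣⇒hasDistinct : ∀ {n k} {S : Subset n} → k ℕ.≤ ∣ S ∣ → HasDistinct S k
≤∣∣⇒hasDistinct {S = S} k≤∣S∣ with enumerate S
... | g , g-inj , S≐g =
  (λ x → g (Fin.inject≤ x k≤∣S∣)) , Fin.inject≤-injective _ _ _ _ ∘ g-inj , λ x → image-∈ S≐g _

hasIndep⇒hasDistinct : ∀ {d n k} (p : Config d n) {S : Subset n} → HasIndep p S k → HasDistinct S k
hasIndep⇒hasDistinct p (f , f∈S , indep) = f , affIndep⇒injective p f indep , f∈S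

hasDistinct⇒hasIndep : ∀ {D n k} {S : Subset n} → k ℕ.≤ suc D → HasDistinct S k → HasIndep (moment {D}) S k
hasDistinct⇒hasIndep k≤D+1 (f , f-inj , f∈S) = f , f∈S , moment-affIndep k≤D+1 f-inj

cubic-roots : ∀ a b c t → (t - a) * (t - b) * (t - c) ≡ 0ℚ ⇔ (t ≡ a ⊎ t ≡ b ⊎ t ≡ c)
cubic-roots a b c t = mk⇔ root vanish
  where
  root : (t - a) * (t - b) * (t - c) ≡ 0ℚ → t ≡ a ⊎ t ≡ b ⊎ t ≡ c
  root r≡0 with x*y≡0⇒x≡0∨y≡0 _ _ r≡0
  ... | inj₂ t-c≡0 = inj₂ (inj₂ (x-y≡0⇒x≡y t c t-c≡0))
  ... | inj₁ [t-a][t-b]≡0 =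
    Sum.map (x-y≡0⇒x≡y t a) (inj₁ ∘ x-y≡0⇒x≡y t b) (x*y≡0⇒x≡0∨y≡0 _ _ [t-a][t-b]≡0)
  vanish : t ≡ a ⊎ t ≡ b ⊎ t ≡ c → (t - a) * (t - b) * (t - c) ≡ 0ℚ
  vanish (inj₁ refl)        = solve 3 (λ a b c → (a :- a) :* (a :- b) :* (a :- c) := con 0ℚ) refl a b c
  vanish (inj₂ (inj₁ refl)) = solve 3 (λ a b c → (b :- a) :* (b :- b) :* (b :- c) := con 0ℚ) refl a b c
  vanish (inj₂ (inj₂ refl)) = solve 3 (λ a b c → (c :- a) :* (c :- b) :* (c :- c) := con 0ℚ) refl a b c

cubic : ℚ → ℚ → ℚ → ℚ → ℚ
cubic σ₁ σ₂ σ₃ t = t ^ 3 - σ₁ * t ^ 2 + σ₂ * t - σ₃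

cubic-factor : ∀ a b c t → cubic (a + b + c) (a * b + a * c + b * c) (a * b * c) t ≡ (t - a) * (t - b) * (t - c)
cubic-factor = solve 4 (λ a b c t →
  t :^ 3 :- (a :+ b :+ c) :* t :^ 2 :+ (a :* b :+ a :* c :+ b :* c) :* t :- a :* b :* c
    := (t :- a) :* (t :- b) :* (t :- c)) refl

2ℚ : ℚ
2ℚ = 1ℚ + 1ℚ

module _ {d′ n : ℕ} where

  -- The coefficients of σ₃² - (cubic σ₁ σ₂ σ₃ t)², a polynomial in t with zero constant term.
  tripleFunctional : ℚ → ℚ → ℚ → Point (6 ℕ.+ d′)
  tripleFunctional σ₁ σ₂ σ₃ zero                                   = 2ℚ * σ₂ * σ₃
  tripleFunctional σ₁ σ₂ σ₃ (suc zero)                             = - (σ₂ * σ₂ + 2ℚ * σ₁ * σ₃)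
  tripleFunctional σ₁ σ₂ σ₃ (suc (suc zero))                       = 2ℚ * (σ₃ + σ₁ * σ₂)
  tripleFunctional σ₁ σ₂ σ₃ (suc (suc (suc zero)))                 = - (σ₁ * σ₁ + 2ℚ * σ₂)
  tripleFunctional σ₁ σ₂ σ₃ (suc (suc (suc (suc zero))))           = 2ℚ * σ₁
  tripleFunctional σ₁ σ₂ σ₃ (suc (suc (suc (suc (suc zero)))))     = - 1ℚ
  tripleFunctional σ₁ σ₂ σ₃ (suc (suc (suc (suc (suc (suc _)))))) = 0ℚ

  tripleFunctional·moment : ∀ σ₁ σ₂ σ₃ (i : Fin n) →
    tripleFunctional σ₁ σ₂ σ₃ · moment i ≡ σ₃ * σ₃ - cubic σ₁ σ₂ σ₃ (node i) * cubic σ₁ σ₂ σ₃ (node i)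
  tripleFunctional·moment σ₁ σ₂ σ₃ i = trans
    (solve 5 (λ s₁ s₂ s₃ t z →
       let r = t :^ 3 :- s₁ :* t :^ 2 :+ s₂ :* t :- s₃ in
       con 2ℚ :* s₂ :* s₃ :* t :^ 1 :+ (:- (s₂ :* s₂ :+ con 2ℚ :* s₁ :* s₃) :* t :^ 2
         :+ (con 2ℚ :* (s₃ :+ s₁ :* s₂) :* t :^ 3 :+ (:- (s₁ :* s₁ :+ con 2ℚ :* s₂) :* t :^ 4
         :+ (con 2ℚ :* s₁ :* t :^ 5 :+ (:- con 1ℚ :* t :^ 6 :+ z)))))
       := s₃ :* s₃ :- r :* r :+ z) refl σ₁ σ₂ σ₃ (node i) _)
    (trans (cong (value +_) tail≡0) (ℚ.+-identityʳ value))
    where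
    value : ℚ
    value = σ₃ * σ₃ - cubic σ₁ σ₂ σ₃ (node i) * cubic σ₁ σ₂ σ₃ (node i)
    tail≡0 : sumFin (λ j → 0ℚ * moment {6 ℕ.+ d′} i (6 Fin.↑ʳ j)) ≡ 0ℚ
    tail≡0 = sumFin-zero (λ j → ℚ.*-zeroˡ (moment {6 ℕ.+ d′} i (6 Fin.↑ʳ j)))

  image₃-isFace : ∀ {S : Subset n} (g : Fin 3 → Fin n) → S IsImageOf g → IsFace (moment {6 ℕ.+ d′}) S
  image₃-isFace {S} g S≐g =
    tripleFunctional σ₁ σ₂ σ₃ , σ₃ * σ₃ , λ i → bound i , mk⇔ (tight i) (tight⁻¹ i)
    where
    a b c σ₁ σ₂ σ₃ : ℚ
    a = node (g zero)
    b = node (g (suc zero))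
    c = node (g (suc (suc zero)))
    σ₁ = a + b + c
    σ₂ = a * b + a * c + b * c
    σ₃ = a * b * c
    r : Fin n → ℚ
    r i = (node i - a) * (node i - b) * (node i - c)
    value : ∀ i → tripleFunctional σ₁ σ₂ σ₃ · moment i ≡ σ₃ * σ₃ - r i * r i
    value i = trans (tripleFunctional·moment σ₁ σ₂ σ₃ i)
                    (cong (λ x → σ₃ * σ₃ - x * x) (cubic-factor a b c (node i)))
    bound : ∀ i → tripleFunctional σ₁ σ₂ σ₃ · moment i ≤ℚ σ₃ * σ₃
    bound i = subst (_≤ℚ σ₃ * σ₃) (sym (value i)) (p-x*x≤p (σ₃ * σ₃) (r i))
    node-root : ∀ j → node (g j) ≡ a ⊎ node (g j) ≡ b ⊎ node (g j) ≡ c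
    node-root zero             = inj₁ refl
    node-root (suc zero)       = inj₂ (inj₁ refl)
    node-root (suc (suc zero)) = inj₂ (inj₂ refl)
    tight : ∀ i → i ∈ S → tripleFunctional σ₁ σ₂ σ₃ · moment i ≡ σ₃ * σ₃
    tight i i∈S with to (S≐g i) i∈S
    ... | j , refl = trans (value (g j))
      (trans (cong (λ x → σ₃ * σ₃ - x * x) (from (cubic-roots a b c _) (node-root j)))
             (ℚ.+-identityʳ (σ₃ * σ₃)))
    tight⁻¹ : ∀ i → tripleFunctional σ₁ σ₂ σ₃ · moment i ≡ σ₃ * σ₃ → i ∈ S
    tight⁻¹ i i-tight = from (S≐g i) (Sum.[ hit zero , Sum.[ hit (suc zero) , hit (suc (suc zero)) ]′ ]′
      (to (cubic-roots a b c (node i)) (p-x*x≡p⇒x≡0 (σ₃ * σ₃) (r i) (trans (sym (value i)) i-tight))))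
      where
      hit : ∀ j → node i ≡ node (g j) → ∃ λ j′ → g j′ ≡ i
      hit j eq = j , sym (node-injective eq)

allSubsets : ∀ n → List (Subset n)
allSubsets zero    = List.[ [] ]
allSubsets (suc n) = List.map (inside ∷_) (allSubsets n) List.++ List.map (outside ∷_) (allSubsets n)

allSubsets-complete : ∀ {n} (S : Subset n) → S ∈ₗ allSubsets n
allSubsets-complete []            = Any.here refl
allSubsets-complete (inside ∷ S)  = ∈-++⁺ˡ (∈-map⁺ (inside ∷_) (allSubsets-complete S))
allSubsets-complete (outside ∷ S) = ∈-++⁺ʳ _ (∈-map⁺ (outside ∷_) (allSubsets-complete S))

allSubsets-unique : ∀ n → Unique (allSubsets n)
allSubsets-unique zero    = [] AllPairs.∷ AllPairs.[]
allSubsets-unique (suc n) = Unique.++⁺ (Unique.map⁺ Vec.∷-injectiveʳ (allSubsets-unique n))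
                                       (Unique.map⁺ Vec.∷-injectiveʳ (allSubsets-unique n)) heads-differ
  where
  heads-differ : ∀ {S} →
    ¬ (S ∈ₗ List.map (inside ∷_) (allSubsets n) × S ∈ₗ List.map (outside ∷_) (allSubsets n))
  heads-differ (S∈ᵢ , S∈ₒ) with ∈-map⁻ (inside ∷_) S∈ᵢ | ∈-map⁻ (outside ∷_) S∈ₒ
  ... | _ , _ , refl | _ , _ , ()

decidable⇒hasCard : ∀ {n} {Q : Subset n → Set} → Decidable Q → ∃ (HasCard Q)
decidable⇒hasCard {n} Q? = _ , List.filter Q? (allSubsets n) , Unique.filter⁺ Q? (allSubsets-unique n) , refl ,
  λ S → mk⇔ (proj₂ ∘ ∈-filter⁻ Q? {xs = allSubsets n}) (∈-filter⁺ Q? (allSubsets-complete S))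

noParNb⇒FRPositive : ∀ {d} (P : Polytope d) → (∀ e → Decidable (Up P e)) →
                     (∀ e e′ → IsEdge P e → ¬ ParNb P e e′) → FRPositive P
noParNb⇒FRPositive P up? no-parNb e e-edge with decidable⇒hasCard (up? e)
... | a , up-card = a , 0 , up-card , no-neighbours , ℕ.<-≤-trans ℕ.z<s (ℕ.m≤n+m 2 a)
  where
  no-neighbours : HasCard (ParNb P e) 0
  no-neighbours = List.[] , AllPairs.[] , refl , λ e′ → mk⇔ (λ ()) (⊥-elim ∘ no-parNb e e′ e-edge)

⁅⁆-isImageOf-const : ∀ {m n} (i : Fin n) → ⁅ i ⁆ IsImageOf (λ (_ : Fin (suc m)) → i)
⁅⁆-isImageOf-const i x = mk⇔ (λ x∈⁅i⁆ → zero , sym (x∈⁅y⁆⇒x≡y i x∈⁅i⁆)) (λ { (_ , refl) → x∈⁅x⁆ i })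

cyclic : (d′ m : ℕ) → Polytope (6 ℕ.+ d′)
cyclic d′ m = record
  { n      = suc (6 ℕ.+ d′) ℕ.+ m
  ; pt     = moment
  ; vertex = λ i → image₃-isFace (λ _ → i) (⁅⁆-isImageOf-const i)
  ; full   = (_↑ˡ m) , (λ _ → ∈⊤) , moment-affIndep ℕ.≤-refl (Fin.↑ˡ-injective m _ _)
  }

module _ {d′ m : ℕ} where
  private
    P : Polytope (6 ℕ.+ d′)
    P = cyclic d′ m
    3≤7+d′ : 3 ℕ.≤ 7 ℕ.+ d′
    3≤7+d′ = s≤s (s≤s (s≤s z≤n))
    4≤7+d′ : 4 ℕ.≤ 7 ℕ.+ d′
    4≤7+d′ = s≤s (s≤s (s≤s (s≤s z≤n)))

  triangle-is2Face : ∀ {S} {g : Fin 3 → Fin (n P)} → Injective _≡_ _≡_ g → S IsImageOf g → Is2Face P S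
  triangle-is2Face {g = g} g-inj S≐g =
    image₃-isFace g S≐g ,
    hasDistinct⇒hasIndep 3≤7+d′ (g , g-inj , image-∈ S≐g) ,
    λ indep₄ → 4≰3 (hasDistinct⇒≤ (hasIndep⇒hasDistinct moment indep₄) S≐g)
    where
    4≰3 : ¬ 4 ℕ.≤ 3
    4≰3 (s≤s (s≤s (s≤s ())))

  is2Face⇔∣∣≡3 : ∀ {S} → Is2Face P S ⇔ ∣ S ∣ ≡ 3
  is2Face⇔∣∣≡3 {S} = mk⇔ card triangle
    where
    card : Is2Face P S → ∣ S ∣ ≡ 3
    card (_ , indep₃ , ¬indep₄) = ℕ.≤-antisym
      (ℕ.≤-pred (ℕ.≰⇒> (¬indep₄ ∘ hasDistinct⇒hasIndep 4≤7+d′ ∘ ≤∣∣⇒hasDistinct)))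
      (hasDistinct⇒≤∣∣ (hasIndep⇒hasDistinct moment indep₃))
    triangle : ∣ S ∣ ≡ 3 → Is2Face P S
    triangle ∣S∣≡3 = let _ , g-inj , S≐g = ∣∣≡⇒enumeration ∣S∣≡3 in triangle-is2Face g-inj S≐g

  up? : ∀ e → Decidable (Up P e)
  up? e F = Dec.map (mk⇔ (λ (e⊆F , ∣F∣≡3) → from is2Face⇔∣∣≡3 ∣F∣≡3 , λ _ → e⊆F)
                         (λ (F-2face , e⊆F) → (λ {i} → e⊆F i) , to is2Face⇔∣∣≡3 F-2face))
                    ((e ⊆? F) ×-dec (∣ F ∣ ℕ.≟ 3))

  adjacent-edges-share-2Face : ∀ {e e′ v} → IsEdge P e → IsEdge P e′ → e′ ≢ e → v ∈ e → v ∈ e′ →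
                               CommonTwoFace P e e′
  adjacent-edges-share-2Face {e} {e′} (_ , ∣e∣≡2) (_ , ∣e′∣≡2) e′≢e v∈e v∈e′
    with ∣∣≡⇒enumeration ∣e∣≡2 | ∣∣≡⇒enumeration ∣e′∣≡2
  ... | _ , g-inj , e≐g | _ , g′-inj , e′≐g′
    with pair-through g-inj e≐g v∈e | pair-through g′-inj e′≐g′ v∈e′
  ... | x , v≢x , e≐ | y , v≢y , e′≐ =
    e ∪ e′ , (triangle , λ _ → p⊆p∪q e′) , (triangle , λ _ → q⊆p∪q e e′)
    where
    x≢y : x ≢ y
    x≢y refl = e′≢e (image-unique e′≐ e≐)
    triangle : Is2Face P (e ∪ e′)
    triangle = triangle-is2Face (lookup-injective ((v≢x ∷ v≢y ∷ []) ∷ (x≢y ∷ []) ∷ [] ∷ []) _ _)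
                                (union-of-pairs e≐ e′≐)

  disjoint-edges-share-no-2Face : ∀ {e e′} → IsEdge P e → IsEdge P e′ → ¬ ShareVertex P e e′ →
                                  ¬ CommonTwoFace P e e′
  disjoint-edges-share-no-2Face (_ , ∣e∣≡2) (_ , ∣e′∣≡2) ¬shared (F , (F-2face , e⊆F) , (_ , e′⊆F))
    with ∣∣≡⇒enumeration ∣e∣≡2 | ∣∣≡⇒enumeration ∣e′∣≡2
  ... | g , g-inj , e≐g | g′ , g′-inj , e′≐g′ = proj₂ (proj₂ F-2face) (hasDistinct⇒hasIndep 4≤7+d′
    (lookup vertices , lookup-injective distinct _ _ , λ where
      zero                   → e⊆F _ (image-∈ e≐g zero)
      (suc zero)             → e⊆F _ (image-∈ e≐g (suc zero))
      (suc (suc zero))       → e′⊆F _ (image-∈ e′≐g′ zero)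
      (suc (suc (suc zero))) → e′⊆F _ (image-∈ e′≐g′ (suc zero))))
    where
    vertices : Vec (Fin (n P)) 4
    vertices = g zero ∷ g (suc zero) ∷ g′ zero ∷ g′ (suc zero) ∷ []
    apart : ∀ j j′ → g j ≢ g′ j′
    apart j j′ eq = ¬shared (g j , image-∈ e≐g j , subst (_∈ _) (sym eq) (image-∈ e′≐g′ j′))
    distinct : Distinct vertices
    distinct = ((λ ()) ∘ g-inj ∷ apart _ _ ∷ apart _ _ ∷ [])
             ∷ (apart _ _ ∷ apart _ _ ∷ [])
             ∷ ((λ ()) ∘ g′-inj ∷ [])
             ∷ [] ∷ []

  no-parallel-neighbours : ∀ e e′ → IsEdge P e → ¬ ParNb P e e′
  no-parallel-neighbours e e′ e-edge (e′-edge , e′≢e , inj₁ ((v , v∈e , v∈e′) , ¬common)) =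
    ¬common (adjacent-edges-share-2Face e-edge e′-edge e′≢e v∈e v∈e′)
  no-parallel-neighbours e e′ e-edge (e′-edge , _ , inj₂ (¬shared , common)) =
    disjoint-edges-share-no-2Face e-edge e′-edge ¬shared common

  cyclic-FRPositive : FRPositive (cyclic d′ m)
  cyclic-FRPositive = noParNb⇒FRPositive P up? no-parallel-neighbours

combEquiv⇒sameVertexCount : ∀ {d d′} (P : Polytope d) (Q : Polytope d′) → CombEquiv P Q → n P ≡ n Q
combEquiv⇒sameVertexCount _ _ (π , _) = ↔⇒≡ π

theorem1p7 : ∀ (d : ℕ) → 6 ≤ d →
    Σ (ℕ → Polytope d) λ P →
      (∀ i → FRPositive (P i)) × (∀ i j → i ≢ j → ¬ CombEquiv (P i) (P j))
theorem1p7 d 6≤d with ℕ.m≤n⇒∃[o]m+o≡n 6≤d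
... | d′ , refl = cyclic d′ , (λ i → cyclic-FRPositive {d′} {i}) , λ i j i≢j Pᵢ≅Pⱼ →
  i≢j (ℕ.+-cancelˡ-≡ (7 ℕ.+ d′) i j (combEquiv⇒sameVertexCount (cyclic d′ i) (cyclic d′ j) Pᵢ≅Pⱼ))
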